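{- Let $\Gamma$ be a finite abelian group and let $x\in\Gamma(3)$ have order $3m$ with $m\not\equiv0\pmod3$. Then $x^m+[x^3]=\langle\!\langle x\rangle\!\rangle$ if $m\equiv1\pmod 3$, and $x^m+[x^3]=\langle\!\langle -x\rangle\!\rangle$ if $m\equiv 2\pmod3$.
   Context: $\Gamma$ is written additively; $x^k$ denotes $kx$ and $-x$ is the inverse of $x$. For $a\in\Gamma$ and $T\subseteq\Gamma$, $a+T=\{a+t:t\in T\}$. $[y]=\{z\in\Gamma:\langle z\rangle=\langle y\rangle\}$. $\Gamma(3)$ is the set of elements whose order is divisible by $3$. For $y\in\Gamma(3)$ with $\mathrm{ord}(y)=q$, put $\langle\!\langle y\rangle\!\rangle=\{y^k:1\le k\le q-1,\ \gcd(k,q)=1,\ k\equiv1\pmod3\}$. -}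

module Defs where

open import Level using (_⊔_; Lift)
open import Algebra.Bundles using (AbelianGroup)
open import Data.Nat using (ℕ; zero; suc; _<_; _≤_)
open import Data.Nat.Coprimality using (Coprime)
open import Data.Nat.DivMod using (_%_)
open import Data.Integer using (ℤ; +_; -[1+_])
open import Data.List using (List)
open import Data.List.Relation.Unary.Any using (Any)
open import Data.Product using (Σ; ∃; _×_)
open import Relation.Binary.PropositionalEquality using (_≡_)
open import Relation.Nullary using (¬_)
open import Relation.Unary using (Pred)

module _ {c ℓ} (G : AbelianGroup c ℓ) where
  open AbelianGroup G renaming (Carrier to Γ)

  Finite : Set (c ⊔ ℓ)
  Finite = Σ (List Γ) λ xs → ∀ (g : Γ) → Any (λ h → g ≈ h) xs

  -- natural multiple  k·x  (written x^k in the paper)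
  infixr 8 _·ₙ_
  _·ₙ_ : ℕ → Γ → Γ
  zero ·ₙ x = ε
  suc k ·ₙ x = x ∙ (k ·ₙ x)

  _·ᶻ_ : ℤ → Γ → Γ
  (+ k) ·ᶻ x = k ·ₙ x
  -[1+ k ] ·ᶻ x = (suc k ·ₙ x) ⁻¹

  IsOrder : Γ → ℕ → Set ℓ
  IsOrder x n = (0 < n) × (n ·ₙ x ≈ ε) × (∀ k → 0 < k → k < n → ¬ (k ·ₙ x ≈ ε))

  Subset : Set (Level.suc (c ⊔ ℓ))
  Subset = Pred Γ (c ⊔ ℓ)

  _≐_ : Subset → Subset → Set (c ⊔ ℓ)
  S ≐ T = (∀ z → S z → T z) × (∀ z → T z → S z)

  ⟨_⟩ : Γ → Subset
  ⟨ y ⟩ z = Lift c (∃ λ (k : ℤ) → z ≈ k ·ᶻ y)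

  [_] : Γ → Subset
  [ y ] z = ⟨ z ⟩ ≐ ⟨ y ⟩

  _+ˢ_ : Γ → Subset → Subset
  (a +ˢ T) z = ∃ λ t → T t × (z ≈ a ∙ t)

  ⟪_⟫ : Γ → Subset
  ⟪ y ⟫ z = Lift c (∃ λ (q : ℕ) → IsOrder y q × ∃ λ (k : ℕ) →
      (1 ≤ k) × (k < q) × Coprime k q × (k % 3 ≡ 1) × (z ≈ k ·ₙ y))

-- Put N = 3m. The generators of ⟨3x⟩, a cyclic group of order m, are the (3b)x with b a unit
-- mod m, so x^m + [x^3] consists of the (m + 3b)x. As 3 ∤ m, these are exactly the r x with r a
-- unit mod N and r ≡ m (mod 3) (any such r is m + 3b modulo N). For m ≡ 1 this is ⟪x⟫. For
-- m ≡ 2 use x = (N − 1)(−x): multiplying by N − 1 ≡ 2 (mod 3) swaps the classes 1 and 2, and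
-- the class-1 unit multiples of −x are ⟪−x⟫.
module Submission where

open import Defs
open import Algebra.Bundles using (AbelianGroup)
open import Data.Nat using (ℕ; _*_)
open import Data.Nat.DivMod using (_%_)
open import Data.Product using (_×_)
open import Relation.Binary.PropositionalEquality using (_≡_; _≢_)

open import Level using (Lift; lift)
open import Data.Nat
  using (zero; suc; pred; _+_; _<_; _≤_; z≤n; s≤s; NonZero; ≢-nonZero; >-nonZero; >-nonZero⁻¹)
open import Data.Nat.Properties using (+-comm; *-comm; <-cmp; suc-pred; *-monoʳ-<; m*n≢0; m*n≢0⇒n≢0)
open import Data.Nat.DivMod
  using (_/_; m≡m%n+[m/n]*n; m%n<n; [m+kn]%n≡m%n; %-distribˡ-*; %-pred-≡0; m∣n⇒o%n%m≡o%m)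
open import Data.Nat.Divisibility
  using (_∣_; ∣-trans; ∣1⇒≡1; n∣m⇒m%n≡0; m%n≡0⇒n∣m; ∣n∣m%n⇒∣m; %-presˡ-∣;
         ∣m∣n⇒∣m+n; ∣m+n∣m⇒∣n; ∣m⇒∣m*n; ∣n⇒∣m*n; m∣m*n)
open import Data.Nat.Coprimality
  using (Coprime; coprime-divisor; coprime-Bézout; coprime-+; prime⇒coprime)
  renaming (sym to coprime-sym)
open import Data.Nat.GCD using (module Bézout)
open import Data.Nat.Primality using (prime?)
open import Data.Nat.Tactic.RingSolver using (solve-∀)
open import Data.Integer using (+_; -[1+_])
open import Data.Product using (∃; _,_; proj₁; proj₂)
open import Data.Empty using (⊥-elim)
open import Function using (_∘_)
open import Relation.Binary using (tri<; tri≈; tri>)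
open import Relation.Nullary using (¬_)
open import Relation.Nullary.Decidable using (from-yes)
open import Relation.Binary.PropositionalEquality as ≡ using (cong)

coprime-* : ∀ {a b c} → Coprime a b → Coprime a c → Coprime a (b * c)
coprime-* cab cac {i} (i∣a , i∣bc) =
  cac (i∣a , coprime-divisor (λ (d∣i , d∣b) → cab (∣-trans d∣i i∣a , d∣b)) i∣bc)

coprime-pred : ∀ {n} .{{_ : NonZero n}} → Coprime (pred n) n
coprime-pred {suc n} {i} (i∣n , i∣1+n) =
  ∣1⇒≡1 (∣m+n∣m⇒∣n (≡.subst (i ∣_) (+-comm 1 n) i∣1+n) i∣n)

coprime-% : ∀ {r n} .{{_ : NonZero n}} → Coprime r n → Coprime (r % n) n
coprime-% cop (i∣r%n , i∣n) = cop (∣n∣m%n⇒∣m i∣n i∣r%n , i∣n)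

coprime-3 : ∀ {m} → m % 3 ≢ 0 → Coprime 3 m
coprime-3 {m} m%3≢0 (i∣3 , i∣m) =
  prime⇒coprime (from-yes (prime? 3)) {{≢-nonZero m%3≢0}} (m%n<n m 3) (i∣3 , %-presˡ-∣ i∣m i∣3)

shift-identity : ∀ e u q p →
  (u + q * suc e) + (u + p + e * q) * suc e ≡ suc e * (u + q * suc e) + (u + p * suc e)
shift-identity = solve-∀

-- The witness is b = (r + (d − 1) m) / d, written via r = u + p d and m = u + q d.
residue-shift : ∀ d {r m} .{{_ : NonZero d}} → r % d ≡ m % d → ∃ λ b → m + b * d ≡ d * m + r
residue-shift d@(suc e) {r} {m} r%d≡m%d =
  m % d + r / d + e * (m / d) ,
  shift (m % d) (m / d) (r / d) (m≡m%n+[m/n]*n m d)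
    (≡.trans (m≡m%n+[m/n]*n r d) (cong (_+ r / d * d) r%d≡m%d))
  where
  shift : ∀ {m r} u q p → m ≡ u + q * d → r ≡ u + p * d → m + (u + p + e * q) * d ≡ d * m + r
  shift u q p ≡.refl ≡.refl = shift-identity e u q p

*-pred-%3 : ∀ {n} r {a} → 3 ∣ suc n → r % 3 ≡ a → (r * n) % 3 ≡ (a * 2) % 3
*-pred-%3 {n} r 3∣1+n ≡.refl = begin
  (r * n) % 3                  ≡⟨ %-distribˡ-* r n 3 ⟩
  (r % 3 * (n % 3)) % 3        ≡⟨ cong (λ v → (r % 3 * v) % 3) n%3≡2 ⟩
  (r % 3 * 2) % 3              ∎
  where
  open ≡.≡-Reasoning
  n%3≡2 : n % 3 ≡ 2
  n%3≡2 = %-pred-≡0 {n} (n∣m⇒m%n≡0 (suc n) 3 3∣1+n)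

UnitIn : ℕ → ℕ → ℕ → Set
UnitIn n a r = Coprime r n × r % 3 ≡ a

module _ {c ℓ} (G : AbelianGroup c ℓ) where
  open AbelianGroup G renaming (Carrier to Γ)
  open import Algebra.Properties.AbelianGroup G
    using (⁻¹-∙-comm; ε⁻¹≈ε; ⁻¹-involutive; inverseʳ-unique)
  open import Algebra.Properties.Monoid.Mult monoid using (×-congʳ; ×-homo-+; ×-assocˡ)
    renaming (_×_ to _×ᴹ_)
  open import Relation.Binary.Reasoning.Setoid setoid

  infixr 8 _·_
  _·_ : ℕ → Γ → Γ
  _·_ = _·ₙ_ G

  ·≗×ᴹ : ∀ n x → n · x ≡ n ×ᴹ x
  ·≗×ᴹ zero x = ≡.refl
  ·≗×ᴹ (suc n) x = cong (x ∙_) (·≗×ᴹ n x)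

  ·-cong : ∀ n {x y} → x ≈ y → n · x ≈ n · y
  ·-cong n {x} {y} x≈y rewrite ·≗×ᴹ n x | ·≗×ᴹ n y = ×-congʳ n x≈y

  ·-homo-+ : ∀ m n x → (m + n) · x ≈ m · x ∙ n · x
  ·-homo-+ m n x rewrite ·≗×ᴹ (m + n) x | ·≗×ᴹ m x | ·≗×ᴹ n x = ×-homo-+ x m n

  ·-assoc : ∀ m n x → m · n · x ≈ (m * n) · x
  ·-assoc m n x rewrite ·≗×ᴹ n x | ·≗×ᴹ m (n ×ᴹ x) | ·≗×ᴹ (m * n) x = ×-assocˡ x m n

  ·-ε : ∀ n → n · ε ≈ ε
  ·-ε zero = refl
  ·-ε (suc n) = trans (identityˡ _) (·-ε n)

  ·-⁻¹ : ∀ n x → n · (x ⁻¹) ≈ (n · x) ⁻¹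
  ·-⁻¹ zero x = sym ε⁻¹≈ε
  ·-⁻¹ (suc n) x = trans (∙-congˡ (·-⁻¹ n x)) (⁻¹-∙-comm x (n · x))

  ·-≡ : ∀ {m n} x → m ≡ n → m · x ≈ n · x
  ·-≡ x m≡n = reflexive (cong (_· x) m≡n)

  ·-comm : ∀ m n x → m · n · x ≈ n · m · x
  ·-comm m n x = trans (·-assoc m n x) (trans (·-≡ x (*-comm m n)) (sym (·-assoc n m x)))

  ·-annihilates : ∀ {n y} k → n · y ≈ ε → (k * n) · y ≈ ε
  ·-annihilates {n} {y} k n·y≈ε = trans (sym (·-assoc k n y)) (trans (·-cong k n·y≈ε) (·-ε k))

  ·-annihilates-· : ∀ {n y} k → n · y ≈ ε → n · k · y ≈ ε
  ·-annihilates-· {n} {y} k n·y≈ε = trans (·-comm n k y) (trans (·-cong k n·y≈ε) (·-ε k))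

  ·-annihilates-⁻¹ : ∀ {n y} → n · y ≈ ε → n · (y ⁻¹) ≈ ε
  ·-annihilates-⁻¹ {n} {y} n·y≈ε = trans (·-⁻¹ n y) (trans (⁻¹-cong n·y≈ε) ε⁻¹≈ε)

  inverse≈pred· : ∀ {n y z} .{{_ : NonZero n}} → n · y ≈ ε → y ∙ z ≈ ε → z ≈ pred n · y
  inverse≈pred· {suc n} {y} {z} n·y≈ε y∙z≈ε =
    trans (inverseʳ-unique y z y∙z≈ε) (sym (inverseʳ-unique y (n · y) n·y≈ε))

  ·-% : ∀ {n y} .{{_ : NonZero n}} → n · y ≈ ε → ∀ k → k · y ≈ (k % n) · y
  ·-% {n} {y} n·y≈ε k = begin
    k · y                                 ≡⟨ cong (_· y) (m≡m%n+[m/n]*n k n) ⟩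
    (k % n + (k / n) * n) · y              ≈⟨ ·-homo-+ (k % n) ((k / n) * n) y ⟩
    (k % n) · y ∙ ((k / n) * n) · y        ≈⟨ ∙-congˡ (·-annihilates (k / n) n·y≈ε) ⟩
    (k % n) · y ∙ ε                        ≈⟨ identityʳ _ ⟩
    (k % n) · y                            ∎

  IsOrder-unique : ∀ {y q n} → IsOrder G y q → IsOrder G y n → q ≡ n
  IsOrder-unique {q = q} {n} (q>0 , q·y≈ε , q-minimal) (n>0 , n·y≈ε , n-minimal)
    with <-cmp q n
  ... | tri< q<n _ _ = ⊥-elim (n-minimal q q>0 q<n q·y≈ε)
  ... | tri≈ _ q≡n _ = q≡n
  ... | tri> _ _ n<q = ⊥-elim (q-minimal n n>0 n<q n·y≈ε)

  IsOrder-⁻¹ : ∀ {y n} → IsOrder G y n → IsOrder G (y ⁻¹) n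
  IsOrder-⁻¹ {y} {n} (n>0 , n·y≈ε , minimal) =
    n>0 , ·-annihilates-⁻¹ {n} n·y≈ε ,
    λ k k>0 k<n k·y⁻¹≈ε → minimal k k>0 k<n
      (trans (sym (⁻¹-involutive _)) (trans (⁻¹-cong (trans (sym (·-⁻¹ k y)) k·y⁻¹≈ε)) ε⁻¹≈ε))

  IsOrder-· : ∀ d {y n} .{{_ : NonZero d}} → IsOrder G y (d * n) → IsOrder G (d · y) n
  IsOrder-· d {y} {n} (d*n>0 , d*n·y≈ε , minimal) =
    >-nonZero⁻¹ n {{m*n≢0⇒n≢0 d {{>-nonZero d*n>0}}}} ,
    trans (·-comm n d y) (trans (·-assoc d n y) d*n·y≈ε) ,
    d·y-minimal
    where
    d·y-minimal : ∀ k → 0 < k → k < n → ¬ (k · d · y ≈ ε)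
    d·y-minimal k k>0 k<n k·d·y≈ε =
      minimal (d * k) (>-nonZero⁻¹ (d * k) {{m*n≢0 d k}}) (*-monoʳ-< d k<n)
        (trans (sym (trans (·-comm k d y) (·-assoc d k y))) k·d·y≈ε)
      where instance _ = >-nonZero k>0

  IsOrder⇒∣ : ∀ {y n k} → IsOrder G y n → k · y ≈ ε → n ∣ k
  IsOrder⇒∣ {y} {n} {k} (n>0 , n·y≈ε , minimal) k·y≈ε =
    m%n≡0⇒n∣m k n (below-order≡0 (k % n) (m%n<n k n) (trans (sym (·-% n·y≈ε k)) k·y≈ε))
    where
    instance _ = >-nonZero n>0
    below-order≡0 : ∀ j → j < n → j · y ≈ ε → j ≡ 0
    below-order≡0 zero _ _ = ≡.refl
    below-order≡0 (suc j) j<n j·y≈ε = ⊥-elim (minimal (suc j) (s≤s z≤n) j<n j·y≈ε)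

  ≐-sym : ∀ {S T} → _≐_ G S T → _≐_ G T S
  ≐-sym (S⊆T , T⊆S) = T⊆S , S⊆T

  ≐-trans : ∀ {S T U} → _≐_ G S T → _≐_ G T U → _≐_ G S U
  ≐-trans (S⊆T , T⊆S) (T⊆U , U⊆T) = (λ z → T⊆U z ∘ S⊆T z) , (λ z → T⊆S z ∘ U⊆T z)

  ⟨⟩-self : ∀ y → ⟨_⟩ G y y
  ⟨⟩-self y = lift (+ 1 , sym (identityʳ y))

  ⟨⟩⇒· : ∀ {n y z} .{{_ : NonZero n}} → n · y ≈ ε → ⟨_⟩ G y z → ∃ λ k → z ≈ k · y
  ⟨⟩⇒· _ (lift (+ k , z≈k·y)) = k , z≈k·y
  ⟨⟩⇒· {n} {y} {z} n·y≈ε (lift (-[1+ k ] , z≈-k·y)) = pred n * suc k , (begin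
    z                       ≈⟨ z≈-k·y ⟩
    (suc k · y) ⁻¹          ≈⟨ inverse≈pred· {n} (·-annihilates-· {n} (suc k) n·y≈ε) (inverseʳ _) ⟩
    pred n · suc k · y      ≈⟨ ·-assoc (pred n) (suc k) y ⟩
    (pred n * suc k) · y    ∎)

  ⟨⟩-⊆ : ∀ {n y t k} .{{_ : NonZero n}} → n · y ≈ ε → t ≈ k · y → ∀ z → ⟨_⟩ G t z → ⟨_⟩ G y z
  ⟨⟩-⊆ {n} {y} {t} {k} n·y≈ε t≈k·y z z∈⟨t⟩
    with j , z≈j·t ← ⟨⟩⇒· {n} (trans (·-cong n t≈k·y) (·-annihilates-· {n} k n·y≈ε)) z∈⟨t⟩ =
    lift (+ (j * k) , trans z≈j·t (trans (·-cong j t≈k·y) (·-assoc j k y)))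

  coprime⇒invertible : ∀ {n y b} .{{_ : NonZero n}} → n · y ≈ ε → Coprime b n →
    ∃ λ u → y ≈ u · b · y
  coprime⇒invertible {n} {y} {b} n·y≈ε b⊥n with coprime-Bézout b⊥n
  ... | Bézout.+- u v 1+v*n≡u*b = u , sym (begin
    u · b · y            ≈⟨ ·-assoc u b y ⟩
    (u * b) · y          ≡⟨ cong (_· y) 1+v*n≡u*b ⟨
    y ∙ (v * n) · y      ≈⟨ ∙-congˡ (·-annihilates v n·y≈ε) ⟩
    y ∙ ε                ≈⟨ identityʳ y ⟩
    y                    ∎)
  ... | Bézout.-+ u v 1+u*b≡v*n = pred n * u , (begin
    y                    ≈⟨ inverse≈pred· {n} (·-annihilates-· {n} u (·-annihilates-· {n} b n·y≈ε))
                                              (trans (comm _ _) y∙u·b·y≈ε) ⟩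
    pred n · u · b · y   ≈⟨ ·-assoc (pred n) u (b · y) ⟩
    (pred n * u) · b · y ∎)
    where
    y∙u·b·y≈ε : y ∙ u · b · y ≈ ε
    y∙u·b·y≈ε = trans (∙-congˡ (·-assoc u b y)) (trans (·-≡ y 1+u*b≡v*n) (·-annihilates v n·y≈ε))

  Multiples : (ℕ → Set) → Γ → Subset G
  Multiples P y z = Lift c (∃ λ r → P r × z ≈ r · y)

  generators≐coprime-multiples : ∀ {y n} → IsOrder G y n →
    _≐_ G ([_] G y) (Multiples (λ b → Coprime b n) y)
  generators≐coprime-multiples {y} {n} ord@(n>0 , n·y≈ε , _) = generator⇒ , ⇒generator
    where
    instance _ = >-nonZero n>0

    generator⇒ : ∀ t → [_] G y t → Multiples (λ b → Coprime b n) y t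
    generator⇒ t (⟨t⟩⊆⟨y⟩ , ⟨y⟩⊆⟨t⟩)
      with b , t≈b·y ← ⟨⟩⇒· {n} n·y≈ε (⟨t⟩⊆⟨y⟩ t (⟨⟩-self t))
      with a , y≈a·t ← ⟨⟩⇒· {n} (trans (·-cong n t≈b·y) (·-annihilates-· {n} b n·y≈ε))
                                 (⟨y⟩⊆⟨t⟩ y (⟨⟩-self y)) =
      lift (b , b⊥n , t≈b·y)
      where
      -- y ≈ (a b)·y, i.e. a b ≡ 1 (mod n), stated without subtraction
      ab+pred·y≈ε : (a * b + pred n) · y ≈ ε
      ab+pred·y≈ε = begin
        (a * b + pred n) · y       ≈⟨ ·-homo-+ (a * b) (pred n) y ⟩
        (a * b) · y ∙ pred n · y   ≈⟨ ∙-congʳ (trans y≈a·t (trans (·-cong a t≈b·y) (·-assoc a b y))) ⟨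
        y ∙ pred n · y             ≡⟨ cong (_· y) (suc-pred n) ⟩
        n · y                      ≈⟨ n·y≈ε ⟩
        ε                          ∎
      b⊥n : Coprime b n
      b⊥n {i} (i∣b , i∣n) =
        coprime-pred (∣m+n∣m⇒∣n (∣-trans i∣n (IsOrder⇒∣ ord ab+pred·y≈ε)) (∣n⇒∣m*n a i∣b) , i∣n)

    ⇒generator : ∀ t → Multiples (λ b → Coprime b n) y t → [_] G y t
    ⇒generator t (lift (b , b⊥n , t≈b·y)) with u , y≈u·b·y ← coprime⇒invertible n·y≈ε b⊥n =
      ⟨⟩-⊆ {n} {k = b} n·y≈ε t≈b·y ,
      ⟨⟩-⊆ {n} {k = u} (trans (·-cong n t≈b·y) (·-annihilates-· {n} b n·y≈ε))
                        (trans y≈u·b·y (·-cong u (sym t≈b·y)))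

  ⟪⟫≐unit-multiples : ∀ {y n} → IsOrder G y n → 3 ∣ n →
    _≐_ G (⟪_⟫ G y) (Multiples (UnitIn n 1) y)
  ⟪⟫≐unit-multiples {y} {n} ord@(n>0 , n·y≈ε , _) 3∣n = from⟪⟫ , to⟪⟫
    where
    instance _ = >-nonZero n>0

    from⟪⟫ : ∀ z → ⟪_⟫ G y z → Multiples (UnitIn n 1) y z
    from⟪⟫ z (lift (q , ord-q , k , _ , _ , k⊥q , k%3≡1 , z≈k·y)) =
      lift (k , (≡.subst (Coprime k) (IsOrder-unique ord-q ord) k⊥q , k%3≡1) , z≈k·y)

    to⟪⟫ : ∀ z → Multiples (UnitIn n 1) y z → ⟪_⟫ G y z
    to⟪⟫ z (lift (r , (r⊥n , r%3≡1) , z≈r·y)) =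
      lift (n , ord , r % n , positive (r % n) r%n%3≡1 , m%n<n r n , coprime-% r⊥n , r%n%3≡1 ,
            trans z≈r·y (·-% {n} n·y≈ε r))
      where
      r%n%3≡1 : r % n % 3 ≡ 1
      r%n%3≡1 = ≡.trans (m∣n⇒o%n%m≡o%m 3 n r 3∣n) r%3≡1
      positive : ∀ k → k % 3 ≡ 1 → 1 ≤ k
      positive (suc k) _ = s≤s z≤n

  unit-multiples-inverse⊆ : ∀ {n y y′} a .{{_ : NonZero n}} → n · y ≈ ε → 3 ∣ n → y ∙ y′ ≈ ε →
    ∀ z → Multiples (UnitIn n a) y′ z → Multiples (UnitIn n ((a * 2) % 3)) y z
  unit-multiples-inverse⊆ {suc n} {y} {y′} a n·y≈ε 3∣n y∙y′≈ε z
    (lift (r , (r⊥n , r%3≡a) , z≈r·y′)) =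
    lift (r * n , (r*n⊥1+n , *-pred-%3 r 3∣n r%3≡a) ,
          trans z≈r·y′ (trans (·-cong r (inverse≈pred· {suc n} n·y≈ε y∙y′≈ε)) (·-assoc r n y)))
    where
    r*n⊥1+n : Coprime (r * n) (suc n)
    r*n⊥1+n = coprime-sym (coprime-* (coprime-sym r⊥n) (coprime-sym coprime-pred))

  m·x+[3·x]≐unit-multiples : ∀ {x} m → IsOrder G x (3 * m) → m % 3 ≢ 0 →
    _≐_ G (_+ˢ_ G (m · x) ([_] G (3 · x))) (Multiples (UnitIn (3 * m) (m % 3)) x)
  m·x+[3·x]≐unit-multiples {x} m ord@(_ , 3m·x≈ε , _) m%3≢0 = translate⇒ , ⇒translate
    where
    [3·x]≐ : _≐_ G ([_] G (3 · x)) (Multiples (λ b → Coprime b m) (3 · x))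
    [3·x]≐ = generators≐coprime-multiples (IsOrder-· 3 ord)

    m·x∙b·3·x≈ : ∀ b → m · x ∙ b · 3 · x ≈ (m + b * 3) · x
    m·x∙b·3·x≈ b = trans (∙-congˡ (·-assoc b 3 x)) (sym (·-homo-+ m (b * 3) x))

    translate⇒ : ∀ z → _+ˢ_ G (m · x) ([_] G (3 · x)) z →
      Multiples (UnitIn (3 * m) (m % 3)) x z
    translate⇒ z (t , t∈[3·x] , z≈m·x∙t) with lift (b , b⊥m , t≈b·3·x) ← proj₁ [3·x]≐ t t∈[3·x] =
      lift (m + b * 3 , (coprime-* r⊥3 r⊥m , r%3≡m%3) ,
            trans z≈m·x∙t (trans (∙-congˡ t≈b·3·x) (m·x∙b·3·x≈ b)))
      where
      r%3≡m%3 : (m + b * 3) % 3 ≡ m % 3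
      r%3≡m%3 = [m+kn]%n≡m%n m b 3
      r⊥3 : Coprime (m + b * 3) 3
      r⊥3 = coprime-sym (coprime-3 (m%3≢0 ∘ ≡.trans (≡.sym r%3≡m%3)))
      r⊥m : Coprime (m + b * 3) m
      r⊥m = coprime-+ (coprime-sym (coprime-* (coprime-sym b⊥m) (coprime-sym (coprime-3 m%3≢0))))

    ⇒translate : ∀ z → Multiples (UnitIn (3 * m) (m % 3)) x z →
      _+ˢ_ G (m · x) ([_] G (3 · x)) z
    ⇒translate z (lift (r , (r⊥3m , r%3≡m%3) , z≈r·x)) with b , shift ← residue-shift 3 r%3≡m%3 =
      b · 3 · x , proj₂ [3·x]≐ _ (lift (b , b⊥m , refl)) , (begin
        z                        ≈⟨ z≈r·x ⟩
        r · x                    ≈⟨ identityˡ _ ⟨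
        ε ∙ r · x                ≈⟨ ∙-congʳ 3m·x≈ε ⟨
        (3 * m) · x ∙ r · x      ≈⟨ ·-homo-+ (3 * m) r x ⟨
        (3 * m + r) · x          ≡⟨ cong (_· x) shift ⟨
        (m + b * 3) · x          ≈⟨ m·x∙b·3·x≈ b ⟨
        m · x ∙ b · 3 · x        ∎)
      where
      b⊥m : Coprime b m
      b⊥m {i} (i∣b , i∣m) = r⊥3m (i∣r , ∣n⇒∣m*n 3 i∣m)
        where
        i∣r : i ∣ r
        i∣r = ∣m+n∣m⇒∣n (≡.subst (i ∣_) shift (∣m∣n⇒∣m+n i∣m (∣m⇒∣m*n 3 i∣b))) (∣n⇒∣m*n 3 i∣m)

  unit-multiples-⁻¹ : ∀ {n y} .{{_ : NonZero n}} → n · y ≈ ε → 3 ∣ n →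
    _≐_ G (Multiples (UnitIn n 2) y) (Multiples (UnitIn n 1) (y ⁻¹))
  unit-multiples-⁻¹ {n} n·y≈ε 3∣n =
    unit-multiples-inverse⊆ 2 (·-annihilates-⁻¹ {n} n·y≈ε) 3∣n (inverseˡ _) ,
    unit-multiples-inverse⊆ 1 n·y≈ε 3∣n (inverseʳ _)

lemma5p2 : ∀ {c ℓ} (G : AbelianGroup c ℓ) → Finite G →
    (x : AbelianGroup.Carrier G) (m : ℕ) →
    IsOrder G x (3 * m) → m % 3 ≢ 0 →
    ((m % 3 ≡ 1) → _≐_ G (_+ˢ_ G (_·ₙ_ G m x) ([_] G (_·ₙ_ G 3 x))) (⟪_⟫ G x))
    × ((m % 3 ≡ 2) → _≐_ G (_+ˢ_ G (_·ₙ_ G m x) ([_] G (_·ₙ_ G 3 x))) (⟪_⟫ G (AbelianGroup._⁻¹ G x)))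
lemma5p2 G _ x m ord@(3m>0 , 3m·x≈ε , _) m%3≢0 =
  (λ m%3≡1 → ≐-trans G (translate≐ m%3≡1) (≐-sym G (⟪⟫≐unit-multiples G ord (m∣m*n m)))) ,
  (λ m%3≡2 → ≐-trans G (translate≐ m%3≡2) (≐-trans G (unit-multiples-⁻¹ G 3m·x≈ε (m∣m*n m))
                 (≐-sym G (⟪⟫≐unit-multiples G (IsOrder-⁻¹ G ord) (m∣m*n m)))))
  where
  instance _ = >-nonZero 3m>0
  translate≐ : ∀ {a} → m % 3 ≡ a →
    _≐_ G (_+ˢ_ G (_·ₙ_ G m x) ([_] G (_·ₙ_ G 3 x))) (Multiples G (UnitIn (3 * m) a) x)
  translate≐ ≡.refl = m·x+[3·x]≐unit-multiples G m ord m%3≢0
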